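{- Let $n\ge1$ and $\alpha^1,\dots,\alpha^n\in\mathrm{ord}$. It is impossible that $\alpha^i<\alpha^1,\dots,\alpha^n$ holds for every $i\in\{1,\dots,n\}$.
   Context: The setting is constructive. Let $\mathfrak F$ be a set of index sets containing $\mathbb N$ and every $\mathbb N_k=\{n\in\mathbb N:n<k\}$, closed (up to isomorphism) under finitely enumerated subsets, sets of finitely enumerated subsets, and disjoint unions indexed by elements of $\mathfrak F$. The set $\mathrm{ord}=\mathrm{ord}_{\mathfrak F}$ is defined inductively: a distinguished element $\underline 0$, and for every $I\in\mathfrak F$ and family $(\alpha_i)_{i\in I}$ in $\mathrm{ord}$ an element $\mathrm S(\alpha_i)_{i\in I}$. For $\alpha=\mathrm S(\alpha_i)_{i\in I}$, $\mathrm{In}_\alpha=I$; by convention $\mathrm{In}_{\underline0}=\emptyset$. For a finite list $F\subseteq_f\mathrm{In}_\alpha$, $\alpha_F$ is the list of the $\alpha_i$, $i\in F$. By simultaneous induction ($m\ge1$): $\alpha\le\beta^1,\dots,\beta^m$ means $\alpha_i<\beta^1,\dots,\beta^m$ for all $i\in\mathrm{In}_\alpha$; $\alpha<\beta^1,\dots,\beta^m$ means there exist finite lists $F_k\subseteq_f\mathrm{In}_{\beta^k}$, not all empty, with $\alpha\le\beta^1_{F_1},\dots,\beta^m_{F_m}$ (the concatenated list). -}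

module Defs where

open import Data.Nat using (ℕ)
open import Data.Fin using (Fin)
open import Data.Product using (Σ; _×_)
open import Data.Empty using (⊥)
open import Data.List using (List; []; _∷_; map; concat; filter)
open import Data.List.Membership.Propositional using (_∈_)
open import Data.List.Relation.Unary.All using (All; []; _∷_)
open import Data.List.Relation.Unary.Any using (Any)
open import Data.Vec using (Vec; lookup; toList)
open import Function.Bundles using (_↔_)
open import Relation.Nullary using (¬_)
open import Relation.Binary.PropositionalEquality using (_≡_; _≢_)

-- A family 𝔉 of index sets, presented as a universe (codes + decoding),
-- with the closure properties of the paper (up to isomorphism).
-- A finitely enumerated subset of a set A is presented by an enumerating
-- list of elements of A; as a set it is {a : A | a ∈ l}.
record IndexFamily : Set₁ where
  field
    Code : Set
    El   : Code → Set
    natC   : Code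
    natIso : El natC ↔ ℕ
    finC   : ℕ → Code
    finIso : ∀ k → El (finC k) ↔ Fin k
    subC   : (I : Code) → List (El I) → Code
    subIso : ∀ I l → El (subC I l) ↔ Σ (El I) (λ a → a ∈ l)
    pfeC   : Code → Code
    pfeIso : ∀ I → El (pfeC I) ↔ List (El I)
    sigC   : (I : Code) → (El I → Code) → Code
    sigIso : ∀ I J → El (sigC I J) ↔ Σ (El I) (λ i → El (J i))

module Ordinals (𝔉 : IndexFamily) where
  open IndexFamily 𝔉

  data Ord : Set where
    𝟎 : Ord
    S : (I : Code) → (El I → Ord) → Ord

  In : Ord → Set
  In 𝟎       = ⊥
  In (S I _) = El I

  sub : (α : Ord) → In α → Ord
  sub (S I f) i = f i

  Sel : List Ord → Set
  Sel βs = All (λ β → List (In β)) βs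

  NotAllEmpty : {βs : List Ord} → Sel βs → Set
  NotAllEmpty []       = ⊥
  NotAllEmpty {β ∷ βs} (F ∷ Fs) = (F ≢ []) Data.Sum.⊎ NotAllEmpty Fs
    where import Data.Sum

  pick : {βs : List Ord} → Sel βs → List Ord
  pick []               = []
  pick {β ∷ βs} (F ∷ Fs) = map (sub β) F Data.List.++ pick Fs

  data _≤_ : Ord → List Ord → Set
  data _<_ : Ord → List Ord → Set

  data _≤_ where
    le : ∀ {α βs} → (∀ (i : In α) → sub α i < βs) → α ≤ βs

  data _<_ where
    lt : ∀ {α βs} (Fs : Sel βs) → NotAllEmpty Fs → α ≤ pick Fs → α < βs

-- A proof of α < βs only uses children of the βs.  So if every member of a
-- nonempty list L satisfied α < L, gathering the witnessing lists would give a
-- nonempty list K of children of members of L with the same property, and so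
-- on forever.  This descent is impossible because "K is a nonempty list of
-- children of members of L" is well founded: accessibility of singletons
-- follows by induction on ord, and accessible lists are closed under _++_.
module Submission where

open import Defs
open import Data.Nat using (ℕ; suc)
open import Data.Fin using (Fin)
open import Data.Vec using (Vec; _∷_; lookup; toList)
import Data.Vec.Relation.Unary.All.Properties as Vecᴬ
open import Data.Empty using (⊥-elim)
open import Data.Product using (Σ-syntax; ∃-syntax; _×_; _,_; proj₁; proj₂)
open import Data.Sum using (_⊎_; inj₁; inj₂)
open import Data.List using (List; []; _∷_; [_]; map; _++_)
open import Data.List.Properties using (++-identityʳ)
open import Data.List.Relation.Unary.All as All using (All; []; _∷_)
import Data.List.Relation.Unary.All.Properties as Allₚ
open import Data.List.Relation.Unary.Any using (here; there)
open import Data.List.Membership.Propositional using (_∈_)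
open import Data.List.Membership.Propositional.Properties using (∈-++⁺ʳ; ∈-++⁻)
open import Data.List.Relation.Binary.Subset.Propositional using (_⊆_)
open import Data.List.Relation.Binary.Subset.Propositional.Properties
  using (⊆-trans; ⊆[]⇒≡[]; xs⊆x∷xs; xs⊆xs++ys; ∷⁺ʳ; ∈-∷⁺ʳ; ++⁺ʳ)
open import Induction.WellFounded using (Acc; acc; WellFounded)
open import Relation.Nullary using (¬_)
open import Relation.Binary.PropositionalEquality using (_≡_; _≢_; refl; subst; sym)

module _ (𝔉 : IndexFamily) where
  open Ordinals 𝔉

  ⊆-≢[] : {xs ys : List Ord} → xs ⊆ ys → xs ≢ [] → ys ≢ []
  ⊆-≢[] xs⊆ys xs≢[] refl = xs≢[] (⊆[]⇒≡[] xs⊆ys)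

  Child : List Ord → Ord → Set
  Child βs x = Σ[ β ∈ Ord ] β ∈ βs × Σ[ j ∈ In β ] sub β j ≡ x

  Child-resp-⊆ : ∀ {βs γs x} → βs ⊆ γs → Child βs x → Child γs x
  Child-resp-⊆ βs⊆γs (β , β∈ , j , e) = β , βs⊆γs β∈ , j , e

  Child-++⁻ : ∀ βs {γs x} → Child (βs ++ γs) x → Child βs x ⊎ Child γs x
  Child-++⁻ βs (β , β∈ , j , e) with ∈-++⁻ βs β∈
  ... | inj₁ β∈βs = inj₁ (β , β∈βs , j , e)
  ... | inj₂ β∈γs = inj₂ (β , β∈γs , j , e)

  infix 4 _◁_
  _◁_ : List Ord → List Ord → Set
  K ◁ L = K ≢ [] × All (Child L) K

  ◁-resp-⊆ : ∀ {K βs γs} → βs ⊆ γs → K ◁ βs → K ◁ γs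
  ◁-resp-⊆ βs⊆γs (K≢[] , cK) = K≢[] , All.map (Child-resp-⊆ βs⊆γs) cK

  pick-children : ∀ {βs} (M : Sel βs) → All (Child βs) (pick M)
  pick-children []                 = []
  pick-children {β ∷ βs} (F ∷ Fs) =
    Allₚ.++⁺ (Allₚ.map⁺ (All.tabulate λ {j} _ → β , here refl , j , refl))
             (All.map (Child-resp-⊆ there) (pick-children Fs))

  NotAllEmpty⇒pick≢[] : ∀ {βs} (M : Sel βs) → NotAllEmpty M → pick M ≢ []
  NotAllEmpty⇒pick≢[] ([] ∷ Fs) (inj₁ F≢[]) = ⊥-elim (F≢[] refl)
  NotAllEmpty⇒pick≢[] ((j ∷ F) ∷ Fs) (inj₁ _) = λ ()
  NotAllEmpty⇒pick≢[] {β ∷ _} (F ∷ Fs) (inj₂ ne) =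
    ⊆-≢[] (∈-++⁺ʳ (map (sub β) F)) (NotAllEmpty⇒pick≢[] Fs ne)

  pick≢[]⇒NotAllEmpty : ∀ {βs} (M : Sel βs) → pick M ≢ [] → NotAllEmpty M
  pick≢[]⇒NotAllEmpty [] pick≢[] = pick≢[] refl
  pick≢[]⇒NotAllEmpty ([] ∷ Fs) pick≢[] = inj₂ (pick≢[]⇒NotAllEmpty Fs pick≢[])
  pick≢[]⇒NotAllEmpty ((j ∷ F) ∷ Fs) _ = inj₁ λ ()

  pick-◁ : ∀ {βs} (M : Sel βs) → NotAllEmpty M → pick M ◁ βs
  pick-◁ M ne = NotAllEmpty⇒pick≢[] M ne , pick-children M

  ∅ : (βs : List Ord) → Sel βs
  ∅ []       = []
  ∅ (_ ∷ βs) = [] ∷ ∅ βs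

  insert : ∀ {β βs} → β ∈ βs → In β → Sel βs → Sel βs
  insert (here refl) j (F ∷ Fs) = (j ∷ F) ∷ Fs
  insert (there β∈)  j (F ∷ Fs) = F ∷ insert β∈ j Fs

  pick-insert-new : ∀ {β βs} (β∈ : β ∈ βs) (j : In β) (M : Sel βs) → sub β j ∈ pick (insert β∈ j M)
  pick-insert-new (here refl) j (F ∷ Fs) = here refl
  pick-insert-new {βs = γ ∷ _} (there β∈) j (F ∷ Fs) =
    ∈-++⁺ʳ (map (sub γ) F) (pick-insert-new β∈ j Fs)

  pick-insert-old : ∀ {β βs} (β∈ : β ∈ βs) (j : In β) (M : Sel βs) → pick M ⊆ pick (insert β∈ j M)
  pick-insert-old (here refl) j (F ∷ Fs) = there
  pick-insert-old {βs = γ ∷ _} (there β∈) j (F ∷ Fs) =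
    ++⁺ʳ (map (sub γ) F) (pick-insert-old β∈ j Fs)

  select : ∀ {βs K} → All (Child βs) K → Σ[ M ∈ Sel βs ] K ⊆ pick M
  select {βs} [] = ∅ βs , λ ()
  select ((β , β∈ , j , refl) ∷ cK) =
    let M , K⊆M = select cK
    in insert β∈ j M , ∈-∷⁺ʳ (pick-insert-new β∈ j M) (⊆-trans K⊆M (pick-insert-old β∈ j M))

  ≤-sub : ∀ {α βs} → α ≤ βs → (i : In α) → sub α i < βs
  ≤-sub (le α≤) = α≤

  Dominated : List Ord → Ord → Set
  Dominated βs α = ∃[ K ] K ◁ βs × α ≤ K

  <⇒Dominated : ∀ {α βs} → α < βs → Dominated βs α
  <⇒Dominated (lt Fs ne α≤) = pick Fs , pick-◁ Fs ne , α≤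

  ≤-resp-⊆ : ∀ {α βs γs} → βs ⊆ γs → α ≤ βs → α ≤ γs
  <-resp-⊆ : ∀ {α βs γs} → βs ⊆ γs → α < βs → α < γs
  ◁≤⇒< : ∀ {α K βs} → K ◁ βs → α ≤ K → α < βs

  ≤-resp-⊆ βs⊆γs (le α≤) = le λ i → <-resp-⊆ βs⊆γs (α≤ i)
  <-resp-⊆ βs⊆γs (lt Fs ne α≤) = ◁≤⇒< (◁-resp-⊆ βs⊆γs (pick-◁ Fs ne)) α≤
  ◁≤⇒< (K≢[] , cK) α≤K =
    let M , K⊆M = select cK
    in lt M (pick≢[]⇒NotAllEmpty M (⊆-≢[] K⊆M K≢[])) (≤-resp-⊆ K⊆M α≤K)

  acc-⊆ : ∀ {K L} → K ⊆ L → Acc _◁_ L → Acc _◁_ K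
  acc-⊆ K⊆L (acc rs) = acc λ K′◁K → rs (◁-resp-⊆ K⊆L K′◁K)

  ¬◁[] : ∀ {K} → ¬ K ◁ []
  ¬◁[] {[]}    (K≢[] , _)             = K≢[] refl
  ¬◁[] {_ ∷ _} (_ , (_ , () , _) ∷ _)

  acc-[] : Acc _◁_ []
  acc-[] = acc λ K◁[] → ⊥-elim (¬◁[] K◁[])

  split-children : ∀ A {B K} → All (Child (A ++ B)) K →
    Σ[ KA ∈ List Ord ] Σ[ KB ∈ List Ord ] All (Child A) KA × All (Child B) KB × K ⊆ KA ++ KB
  split-children A [] = [] , [] , [] , [] , λ ()
  split-children A {K = x ∷ _} (c ∷ cK) with split-children A cK | Child-++⁻ A c
  ... | KA , KB , cA , cB , K⊆ | inj₁ cx = x ∷ KA , KB , cx ∷ cA , cB , ∷⁺ʳ x K⊆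
  ... | KA , KB , cA , cB , K⊆ | inj₂ cx =
    KA , x ∷ KB , cA , cx ∷ cB ,
    ∈-∷⁺ʳ (∈-++⁺ʳ KA (here refl)) (⊆-trans K⊆ (++⁺ʳ KA (xs⊆x∷xs KB x)))

  acc-++ : ∀ {A B} → Acc _◁_ A → Acc _◁_ B → Acc _◁_ (A ++ B)
  acc-++ {A} {B} (acc rsA) (acc rsB) = acc λ {K} (K≢[] , cK) →
    let KA , KB , cA , cB , K⊆ = split-children A cK
    in acc-⊆ K⊆ (acc-parts KA KB cA cB (⊆-≢[] K⊆ K≢[]))
    where
    acc-parts : ∀ KA KB → All (Child A) KA → All (Child B) KB → KA ++ KB ≢ [] → Acc _◁_ (KA ++ KB)
    acc-parts []       []       _  _  ne = ⊥-elim (ne refl)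
    acc-parts []       (_ ∷ _)  _  cB _  = rsB ((λ ()) , cB)
    acc-parts KA@(_ ∷ _) []     cA _  _  = subst (Acc _◁_) (sym (++-identityʳ KA)) (rsA ((λ ()) , cA))
    acc-parts (_ ∷ _)  (_ ∷ _)  cA cB _  = acc-++ (rsA ((λ ()) , cA)) (rsB ((λ ()) , cB))

  acc-all : ∀ {K} → All (λ x → Acc _◁_ [ x ]) K → Acc _◁_ K
  acc-all []         = acc-[]
  acc-all (ax ∷ axs) = acc-++ ax (acc-all axs)

  acc-singleton : ∀ β → (∀ j → Acc _◁_ [ sub β j ]) → Acc _◁_ [ β ]
  acc-singleton β acc-sub = acc λ (_ , cK) →
    acc-all (All.map (λ { (_ , here refl , j , refl) → acc-sub j }) cK)

  acc-[_] : ∀ β → Acc _◁_ [ β ]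
  acc-[ 𝟎 ]     = acc-singleton 𝟎 λ ()
  acc-[ S I f ] = acc-singleton (S I f) λ j → acc-[ f j ]

  ◁-wellFounded : WellFounded _◁_
  ◁-wellFounded L = acc-all (All.tabulate λ {β} _ → acc-[ β ])

  union : ∀ {L βs} → All (Dominated L) βs → List Ord
  union []             = []
  union ((K , _) ∷ ws) = K ++ union ws

  union-children : ∀ {L βs} (ws : All (Dominated L) βs) → All (Child L) (union ws)
  union-children []                        = []
  union-children ((_ , (_ , cK) , _) ∷ ws) = Allₚ.++⁺ cK (union-children ws)

  union-⊇ : ∀ {L β βs} (ws : All (Dominated L) βs) (β∈ : β ∈ βs) →
            proj₁ (All.lookup ws β∈) ⊆ union ws
  union-⊇ ((K , _) ∷ ws) (here refl) = xs⊆xs++ys K (union ws)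
  union-⊇ ((K , _) ∷ ws) (there β∈)  = ⊆-trans (union-⊇ ws β∈) (∈-++⁺ʳ K)

  descend : ∀ {L} → L ≢ [] → All (_< L) L → ∃[ K ] K ◁ L × All (_< K) K
  descend {[]}    L≢[] _  = ⊥-elim (L≢[] refl)
  descend {L@(_ ∷ _)} _ hs@(h ∷ _) =
    union ws , (union≢[] , union-children ws) , All.map dominated (union-children ws)
    where
    ws : All (Dominated L) L
    ws = All.map <⇒Dominated hs
    union≢[] : union ws ≢ []
    union≢[] = let _ , (K≢[] , _) , _ = <⇒Dominated h in ⊆-≢[] (xs⊆xs++ys _ _) K≢[]
    dominated : ∀ {x} → Child L x → x < union ws
    dominated (β , β∈ , j , refl) =
      <-resp-⊆ (union-⊇ ws β∈) (≤-sub (proj₂ (proj₂ (All.lookup ws β∈))) j)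

  ¬All<self : ∀ {L} → Acc _◁_ L → L ≢ [] → ¬ All (_< L) L
  ¬All<self (acc rs) L≢[] hs =
    let K , K◁L@(K≢[] , _) , hsK = descend L≢[] hs
    in ¬All<self (rs K◁L) K≢[] hsK

lemma4p5 : (𝔉 : IndexFamily) → let open Ordinals 𝔉 in
    (n : ℕ) → (αs : Vec Ord (suc n)) →
      ¬ (∀ (i : Fin (suc n)) → lookup αs i < toList αs)
lemma4p5 𝔉 n αs@(_ ∷ _) all< =
  ¬All<self 𝔉 (◁-wellFounded 𝔉 (toList αs)) (λ ()) (Vecᴬ.toList⁺ (Vecᴬ.lookup⁻ all<))
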